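{- Let $G$ be a graph on $n>1$ vertices with fixed monotone local functions $f_i$; each permutation $\pi$ of the vertices induces the SDS $(G,f,\pi)$. For every fixed state $X\in\mathbb{F}_2^n$, the probability, over a uniformly random permutation $\pi$, that $X$ is either a Garden-of-Eden state or reaches a fixed point of $(G,f,\pi)$ is at least $2/\binom{n}{\lfloor n/2\rfloor}$. Furthermore, the probability, over a uniformly random state $X$ and an independent uniformly random permutation $\pi$, that $X$ is either a Garden-of-Eden state or reaches a fixed point of $(G,f,\pi)$ is at least $n/2^{n-1}$.
   Context: An SDS $(G,f,\pi)$: $G$ a simple graph with vertex set $\{1,\dots,n\}$, vertex states in $\mathbb{F}_2=\{0,1\}$, each vertex $i$ with a local function $f_i$ of the states of $i$ and its neighbours, inflated to $F_i:\mathbb{F}_2^n\to\mathbb{F}_2^n$ (replace coordinate $i$ by the value of $f_i$, fix other coordinates); for a permutation $\pi=\pi_1\cdots\pi_n$ of the vertices, $F_\pi=F_{\pi_n}\circ\cdots\circ F_{\pi_1}$. Order $\mathbb{F}_2^n$ componentwise with $0<1$; $f_i$ monotone means $X\le Y\Rightarrow f_i(X)\le f_i(Y)$. $X$ is a Garden-of-Eden state if no $Y$ satisfies $F_\pi(Y)=X$; $X$ reaches a fixed point if $F_\pi^m(X)$ is a fixed point of $F_\pi$ for some $m\ge0$. -}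

module Defs where

open import Data.Nat using (ℕ; zero; suc)
open import Data.Bool using (Bool; false; true) renaming (_≤_ to _≤ᵇ_)
open import Data.Fin using (Fin)
open import Data.Vec using (Vec; lookup; _[_]≔_)
open import Data.List using (List; foldl; allFin)
open import Data.List.Relation.Binary.Permutation.Propositional using (_↭_)
open import Data.Product using (Σ; ∃; _×_)
open import Data.Sum using (_⊎_)
open import Relation.Binary.PropositionalEquality using (_≡_; _≢_)
open import Relation.Nullary using (¬_)

-- A state of the system: an element of 𝔽₂ⁿ, with 𝔽₂ = Bool (false = 0, true = 1).
State : ℕ → Set
State n = Vec Bool n

record SimpleGraph (n : ℕ) : Set₁ where
  field
    Adj   : Fin n → Fin n → Set
    sym   : ∀ {i j} → Adj i j → Adj j i
    irrefl : ∀ {i} → ¬ Adj i i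

_≤ₛ_ : ∀ {n} → State n → State n → Set
X ≤ₛ Y = ∀ j → lookup X j ≤ᵇ lookup Y j

IsLocal : ∀ {n} → SimpleGraph n → (Fin n → State n → Bool) → Set
IsLocal {n} G f = ∀ (i : Fin n) (X Y : State n) →
  (∀ j → (j ≡ i ⊎ SimpleGraph.Adj G i j) → lookup X j ≡ lookup Y j) →
  f i X ≡ f i Y

IsMonotone : ∀ {n} → (Fin n → State n → Bool) → Set
IsMonotone {n} f = ∀ (i : Fin n) (X Y : State n) → X ≤ₛ Y → f i X ≤ᵇ f i Y

IsPermutation : ∀ {n} → List (Fin n) → Set
IsPermutation {n} w = w ↭ allFin n

F : ∀ {n} → (Fin n → State n → Bool) → Fin n → State n → State n
F f i X = X [ i ]≔ f i X

-- SDS map F_π = F_{πₙ} ∘ ⋯ ∘ F_{π₁} (π₁ applied first).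
SDS : ∀ {n} → (Fin n → State n → Bool) → List (Fin n) → State n → State n
SDS f π X = foldl (λ Y i → F f i Y) X π

iterate : ∀ {A : Set} → (A → A) → ℕ → A → A
iterate g zero x = x
iterate g (suc m) x = g (iterate g m x)

IsFixedPoint : ∀ {n} → (Fin n → State n → Bool) → List (Fin n) → State n → Set
IsFixedPoint f π X = SDS f π X ≡ X

IsGardenOfEden : ∀ {n} → (Fin n → State n → Bool) → List (Fin n) → State n → Set
IsGardenOfEden {n} f π X = ∀ (Y : State n) → SDS f π Y ≢ X

ReachesFixedPoint : ∀ {n} → (Fin n → State n → Bool) → List (Fin n) → State n → Set
ReachesFixedPoint f π X = ∃ λ m → IsFixedPoint f π (iterate (SDS f π) m X)

-- Write T for the vertices where the state X equals d and S for the others, and let ⊑ be the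
-- componentwise order pointing away from the constant state d (≤ for d = 0, ≥ for d = 1).
-- Suppose π lists T before S and X = F_π(Y); put V = F_T(X) and W = F_T(Y).  Then X ⊑ V, since F_T
-- only moves coordinates at which X sits at the bottom d; and W ⊑ V, since on S the state V is at
-- the top ¬d, while off S the coordinates of W are not touched by F_S and so equal those of X.
-- Monotonicity gives X = F_S(W) ⊑ F_S(V) = F_π(X), so the orbit of X climbs in ⊑ and, the Hamming
-- distance to d being at most n, stops at a fixed point.  Hence X is a Garden-of-Eden state or
-- reaches a fixed point under the |T|!|S|! permutations listing T first, and, if X is not constant,
-- under as many listing S first; as k!(n-k)! is minimal at k = ⌊n/2⌋ these are at least
-- 2 n!/C(n,⌊n/2⌋) permutations.  For the second claim, every permutation π serves the 2n states that
-- are b on the first c vertices of π and ¬b on the rest, for b ∈ 𝔽₂ and c < n.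

module Submission where

open import Defs
open import Data.Bool as Bool using (Bool; false; true; not; _xor_; if_then_else_; f≤t; b≤b)
  renaming (_≤_ to _≤ᵇ_)
open import Data.Bool.Properties as Boolₚ using (¬-not; not-¬; not-injective)
open import Data.Empty using (⊥-elim)
open import Data.Fin as Fin using (Fin; toℕ)
import Data.Fin.Properties as Finₚ
open import Data.Fin.Subset.Properties using (anySubset?)
open import Data.List
  using (List; []; _∷_; _++_; length; map; filter; concatMap; cartesianProductWith; allFin; take; drop; lookup; head)
open import Data.List.Properties
  using (take++drop≡id; foldl-++; length-tabulate; length-++; length-map; ++-cancelˡ; ∷-injectiveˡ; ∷-injectiveʳ)
open import Data.List.Membership.Propositional using (_∈_; _∉_; find)
open import Data.List.Membership.Propositional.Properties
  using (∈-cartesianProductWith⁻; ∈-map⁻; ∈-concatMap⁻; ∈-lookup)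
open import Data.List.Relation.Binary.Disjoint.Propositional using (Disjoint)
open import Data.List.Relation.Binary.Permutation.Propositional
  using (_↭_; ↭-refl; ↭-sym; ↭-trans; prep; swap; ↭⇒↭ₛ)
open import Data.List.Relation.Binary.Permutation.Propositional.Properties
  using (∈-resp-↭; All-resp-↭; ↭-length; shift; ++⁺)
open import Data.List.Relation.Binary.Permutation.Setoid.Properties using (Unique-resp-↭)
open import Data.List.Relation.Unary.All as All using (All; []; _∷_)
open import Data.List.Relation.Unary.All.Properties as All using ()
open import Data.List.Relation.Unary.AllPairs using ([]; _∷_)
open import Data.List.Relation.Unary.Any using (here; there)
open import Data.List.Relation.Unary.Unique.Propositional using (Unique)
import Data.List.Relation.Unary.Unique.Propositional.Properties as Unique
open import Data.Maybe using (just)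
open import Data.Nat using (ℕ; zero; suc; _<_; _≤_; _+_; _*_; _^_; _∸_; _/_; _!; z≤n; s≤s; ⌊_/2⌋; ⌈_/2⌉)
open import Data.Nat.Combinatorics using (_C_; k![n∸k]!∣n!)
open import Data.Nat.Combinatorics.Specification using (nCk≡n!/k![n-k]!)
open import Data.Nat.DivMod using (m/n*n≡m; m/n≡1+[m∸n]/n)
open import Data.Nat.Properties
  using (≤-refl; ≤-reflexive; ≤-trans; ≤-<-trans; <-irrefl; <⇒≤; ≤-total; 0≢1+n; suc-injective;
         +-comm; +-assoc; +-suc; +-identityʳ; +-mono-≤; +-monoʳ-≤; +-monoʳ-<; +-mono-<-≤; +-cancelˡ-≡;
         *-comm; *-assoc; *-identityˡ; *-distribʳ-+; *-monoˡ-≤; *-monoʳ-≤; *-commutativeSemigroup;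
         m≤m+n; m+[n∸m]≡n; m+n∸m≡n; _!*_!≢0;
         n≡⌊n+n/2⌋; ⌊n/2⌋-mono; ⌊n/2⌋≤n; ⌊n/2⌋≤⌈n/2⌉; ⌊n/2⌋+⌈n/2⌉≡n; module ≤-Reasoning)
open import Data.Nat.Solver using (module +-*-Solver)
open import Data.Product using (Σ; ∃; ∃₂; _×_; _,_; proj₁; proj₂)
open import Data.Sum using (_⊎_; inj₁; inj₂)
open import Data.Vec using ([]; _∷_; tabulate) renaming (lookup to lookupᵥ)
open import Data.Vec.Properties using (lookup∘tabulate; lookup∘update; lookup∘update′; ≡-dec)
open import Algebra.Properties.CommutativeSemigroup *-commutativeSemigroup using (x∙yz≈y∙xz)
open import Function using (_∘_; id)
open import Relation.Binary.Definitions using (DecidableEquality; tri<; tri≈; tri>)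
open import Relation.Binary.PropositionalEquality
  using (_≡_; _≢_; refl; sym; trans; cong; cong₂; subst; subst₂; setoid; module ≡-Reasoning)
open import Relation.Nullary using (yes; no; does)
open import Relation.Nullary.Decidable using (dec-true; dec-false)
open import Relation.Unary using (Pred; Decidable)
open import Relation.Unary.Properties using (∁?)

infix 4 _⊑[_]_ _⊑ₛ[_]_

-- a ⊑[ d ] b : b lies at least as far from d as a does.
_⊑[_]_ : Bool → Bool → Bool → Set
a ⊑[ false ] b = a ≤ᵇ b
a ⊑[ true ]  b = b ≤ᵇ a

_⊑ₛ[_]_ : ∀ {n} → State n → Bool → State n → Set
X ⊑ₛ[ d ] Y = ∀ j → lookupᵥ X j ⊑[ d ] lookupᵥ Y j

⊑-refl : ∀ d {a} → a ⊑[ d ] a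
⊑-refl false = Boolₚ.≤-refl
⊑-refl true  = Boolₚ.≤-refl

⊑-bottom : ∀ d b → d ⊑[ d ] b
⊑-bottom false = Boolₚ.≤-minimum
⊑-bottom true  = Boolₚ.≤-maximum

⊑-top : ∀ d a → a ⊑[ d ] not d
⊑-top false = Boolₚ.≤-maximum
⊑-top true  = Boolₚ.≤-minimum

top-⊑ : ∀ d {b} → not d ⊑[ d ] b → b ≡ not d
top-⊑ false b≤b = refl
top-⊑ true  b≤b = refl

monotone-⊑ : ∀ {n} {f : Fin n → State n → Bool} → IsMonotone f →
             ∀ d i {X Y} → X ⊑ₛ[ d ] Y → f i X ⊑[ d ] f i Y
monotone-⊑ mono false i X⊑Y = mono i _ _ X⊑Y
monotone-⊑ mono true  i X⊑Y = mono i _ _ X⊑Y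

mismatch : Bool → Bool → ℕ
mismatch d x = if d xor x then 1 else 0

mismatch≤1 : ∀ d x → mismatch d x ≤ 1
mismatch≤1 false false = z≤n
mismatch≤1 false true  = ≤-refl
mismatch≤1 true  false = ≤-refl
mismatch≤1 true  true  = z≤n

mismatch-mono : ∀ d {a b} → a ⊑[ d ] b → mismatch d a ≤ mismatch d b
mismatch-mono false f≤t = z≤n
mismatch-mono false b≤b = ≤-refl
mismatch-mono true  f≤t = z≤n
mismatch-mono true  b≤b = ≤-refl

mismatch-strict : ∀ d {a b} → a ⊑[ d ] b → a ≢ b → mismatch d a < mismatch d b
mismatch-strict false f≤t _   = ≤-refl
mismatch-strict false b≤b a≢a = ⊥-elim (a≢a refl)
mismatch-strict true  f≤t _   = ≤-refl
mismatch-strict true  b≤b a≢a = ⊥-elim (a≢a refl)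

distance : ∀ {n} → Bool → State n → ℕ
distance d []      = 0
distance d (x ∷ X) = mismatch d x + distance d X

distance≤n : ∀ {n} d (X : State n) → distance d X ≤ n
distance≤n d []      = z≤n
distance≤n d (x ∷ X) = +-mono-≤ (mismatch≤1 d x) (distance≤n d X)

distance-mono : ∀ d {n} {X Y : State n} → X ⊑ₛ[ d ] Y → distance d X ≤ distance d Y
distance-mono d {X = []}    {[]}    _   = z≤n
distance-mono d {X = x ∷ X} {y ∷ Y} X⊑Y =
  +-mono-≤ (mismatch-mono d (X⊑Y Fin.zero)) (distance-mono d {X = X} {Y} (X⊑Y ∘ Fin.suc))

distance-strict : ∀ d {n} {X Y : State n} → X ⊑ₛ[ d ] Y → X ≢ Y → distance d X < distance d Y
distance-strict d {X = []}    {[]}    _   X≢Y = ⊥-elim (X≢Y refl)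
distance-strict d {X = x ∷ X} {y ∷ Y} X⊑Y X≢Y with x Bool.≟ y
... | yes refl =
  +-monoʳ-< (mismatch d x) (distance-strict d {X = X} {Y} (X⊑Y ∘ Fin.suc) (X≢Y ∘ cong (x ∷_)))
... | no  x≢y  =
  +-mono-<-≤ (mismatch-strict d (X⊑Y Fin.zero) x≢y) (distance-mono d {X = X} {Y} (X⊑Y ∘ Fin.suc))

module _ {A : Set} (_≟_ : DecidableEquality A) {g : A → A} {_≼_ : A → A → Set}
         (g-mono : ∀ {x y} → x ≼ y → g x ≼ g y)
         (rank : A → ℕ) {N : ℕ} (rank≤N : ∀ x → rank x ≤ N)
         (rank-strict : ∀ {x y} → x ≼ y → x ≢ y → rank x < rank y) where

  increasing-orbit-reaches-fixed-point : ∀ {x} → x ≼ g x → ∃ λ m → g (iterate g m x) ≡ iterate g m x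
  increasing-orbit-reaches-fixed-point {x} x≼gx with climb (suc N)
    where
    orbit-increasing : ∀ k → iterate g k x ≼ iterate g (suc k) x
    orbit-increasing zero    = x≼gx
    orbit-increasing (suc k) = g-mono (orbit-increasing k)

    climb : ∀ k → (∃ λ m → g (iterate g m x) ≡ iterate g m x) ⊎ k ≤ rank (iterate g k x)
    climb zero = inj₂ z≤n
    climb (suc k) with climb k
    ... | inj₁ fixed = inj₁ fixed
    ... | inj₂ k≤rank with g (iterate g k x) ≟ iterate g k x
    ...   | yes fixed = inj₁ (k , fixed)
    ...   | no  moved = inj₂ (≤-<-trans k≤rank (rank-strict (orbit-increasing k) (moved ∘ sym)))
  ... | inj₁ fixed = fixed
  ... | inj₂ N<rank = ⊥-elim (<-irrefl refl (≤-trans N<rank (rank≤N _)))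

module _ {n : ℕ} (f : Fin n → State n → Bool) where

  open import Data.List.Membership.DecPropositional (Fin._≟_ {n}) using (_∈?_)

  F-monotone : IsMonotone f → ∀ d i {X Y} → X ⊑ₛ[ d ] Y → F f i X ⊑ₛ[ d ] F f i Y
  F-monotone mono d i {X} {Y} X⊑Y j with j Fin.≟ i
  ... | yes refl =
    subst₂ _⊑[ d ]_ (sym (lookup∘update i X (f i X))) (sym (lookup∘update i Y (f i Y)))
      (monotone-⊑ mono d i {X} {Y} X⊑Y)
  ... | no  j≢i  =
    subst₂ _⊑[ d ]_ (sym (lookup∘update′ j≢i X (f i X))) (sym (lookup∘update′ j≢i Y (f i Y))) (X⊑Y j)

  SDS-monotone : IsMonotone f → ∀ d π {X Y} → X ⊑ₛ[ d ] Y → SDS f π X ⊑ₛ[ d ] SDS f π Y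
  SDS-monotone mono d []      X⊑Y = X⊑Y
  SDS-monotone mono d (i ∷ π) {X} {Y} X⊑Y = SDS-monotone mono d π (F-monotone mono d i {X} {Y} X⊑Y)

  SDS-++ : ∀ π ρ X → SDS f (π ++ ρ) X ≡ SDS f ρ (SDS f π X)
  SDS-++ π ρ X = foldl-++ (λ Y i → F f i Y) X π ρ

  lookup-SDS-∉ : ∀ π X {j} → j ∉ π → lookupᵥ (SDS f π X) j ≡ lookupᵥ X j
  lookup-SDS-∉ []      X j∉π = refl
  lookup-SDS-∉ (i ∷ π) X j∉π =
    trans (lookup-SDS-∉ π (F f i X) (j∉π ∘ there)) (lookup∘update′ (j∉π ∘ here) X (f i X))

  SDS-stays-above : ∀ d T {X V} → All (λ t → lookupᵥ X t ≡ d) T →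
                    X ⊑ₛ[ d ] V → X ⊑ₛ[ d ] SDS f T V
  SDS-stays-above d []      []             X⊑V = X⊑V
  SDS-stays-above d (t ∷ T) {X} {V} (Xt≡d ∷ XT≡d) X⊑V = SDS-stays-above d T {X} XT≡d X⊑FV
    where
    X⊑FV : X ⊑ₛ[ d ] F f t V
    X⊑FV j with j Fin.≟ t
    ... | yes refl = subst₂ _⊑[ d ]_ (sym Xt≡d) (sym (lookup∘update t V (f t V))) (⊑-bottom d (f t V))
    ... | no  j≢t  = subst (lookupᵥ X j ⊑[ d ]_) (sym (lookup∘update′ j≢t V (f t V))) (X⊑V j)

  preimage⇒⊑-image : IsMonotone f → ∀ d T S {X Y} →
                     All (λ t → lookupᵥ X t ≡ d) T → All (λ s → lookupᵥ X s ≡ not d) S →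
                     SDS f (T ++ S) Y ≡ X → X ⊑ₛ[ d ] SDS f (T ++ S) X
  preimage⇒⊑-image mono d T S {X} {Y} XT≡d XS≡¬d Y↦X =
    subst₂ (λ A B → A ⊑ₛ[ d ] B) SW≡X (sym (SDS-++ T S X)) (SDS-monotone mono d S W⊑V)
    where
    V = SDS f T X
    W = SDS f T Y

    SW≡X : SDS f S W ≡ X
    SW≡X = trans (sym (SDS-++ T S Y)) Y↦X

    X⊑V : X ⊑ₛ[ d ] V
    X⊑V = SDS-stays-above d T {X} XT≡d (λ j → ⊑-refl d)

    W⊑V : W ⊑ₛ[ d ] V
    W⊑V j with j ∈? S
    ... | yes j∈S = subst (lookupᵥ W j ⊑[ d ]_) (sym Vj≡¬d) (⊑-top d (lookupᵥ W j))
      where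
      Vj≡¬d : lookupᵥ V j ≡ not d
      Vj≡¬d = top-⊑ d (subst (_⊑[ d ] lookupᵥ V j) (All.lookup XS≡¬d j∈S) (X⊑V j))
    ... | no  j∉S = subst (_⊑[ d ] lookupᵥ V j) Xj≡Wj (X⊑V j)
      where
      Xj≡Wj : lookupᵥ X j ≡ lookupᵥ W j
      Xj≡Wj = trans (cong (λ Z → lookupᵥ Z j) (sym SW≡X)) (lookup-SDS-∉ S W j∉S)

  goe-or-reaches-fixed-point : IsMonotone f → ∀ d T S {X} →
                               All (λ t → lookupᵥ X t ≡ d) T → All (λ s → lookupᵥ X s ≡ not d) S →
                               IsGardenOfEden f (T ++ S) X ⊎ ReachesFixedPoint f (T ++ S) X
  goe-or-reaches-fixed-point mono d T S {X} XT≡d XS≡¬d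
    with anySubset? (λ Y → ≡-dec Bool._≟_ (SDS f (T ++ S) Y) X)
  ... | no  ∄preimage  = inj₁ (λ Y Y↦X → ∄preimage (Y , Y↦X))
  ... | yes (Y , Y↦X) = inj₂
    (increasing-orbit-reaches-fixed-point (≡-dec Bool._≟_) {_≼_ = λ A B → A ⊑ₛ[ d ] B}
      (SDS-monotone mono d (T ++ S)) (distance d) (distance≤n d) (distance-strict d)
      (preimage⇒⊑-image mono d T S XT≡d XS≡¬d Y↦X))

!*!-shift : ∀ {a b} → a ≤ b → suc a ! * b ! ≤ a ! * suc b !
!*!-shift {a} {b} a≤b = begin
  suc a ! * b !          ≡⟨ *-assoc (suc a) (a !) (b !) ⟩
  suc a * (a ! * b !)    ≤⟨ *-monoˡ-≤ (a ! * b !) (s≤s a≤b) ⟩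
  suc b * (a ! * b !)    ≡⟨ x∙yz≈y∙xz (suc b) (a !) (b !) ⟩
  a ! * suc b !          ∎
  where open ≤-Reasoning

!*!-spread : ∀ j {a b} → a + j ≤ b → (a + j) ! * b ! ≤ a ! * (b + j) !
!*!-spread zero    {a} {b} _ rewrite +-identityʳ a | +-identityʳ b = ≤-refl
!*!-spread (suc j) {a} {b} a+j+1≤b = begin
  (a + suc j) ! * b !   ≡⟨ cong (λ k → k ! * b !) (+-suc a j) ⟩
  (suc a + j) ! * b !   ≤⟨ !*!-spread j (subst (_≤ b) (+-suc a j) a+j+1≤b) ⟩
  suc a ! * (b + j) !   ≤⟨ !*!-shift (≤-trans (m≤m+n a (suc j)) (≤-trans a+j+1≤b (m≤m+n b j))) ⟩
  a ! * suc (b + j) !   ≡⟨ cong (λ k → a ! * k !) (+-suc b j) ⟨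
  a ! * (b + suc j) !   ∎
  where open ≤-Reasoning

⌊n/2⌋!*⌈n/2⌉!-minimal-≤ : ∀ {a b} → a ≤ b → ⌊ a + b /2⌋ ! * ⌈ a + b /2⌉ ! ≤ a ! * b !
⌊n/2⌋!*⌈n/2⌉!-minimal-≤ {a} {b} a≤b = begin
  m ! * m′ !         ≡⟨ cong (λ k → k ! * m′ !) a+j≡m ⟨
  (a + j) ! * m′ !   ≤⟨ !*!-spread j (subst (_≤ m′) (sym a+j≡m) (⌊n/2⌋≤⌈n/2⌉ (a + b))) ⟩
  a ! * (m′ + j) !   ≡⟨ cong (λ k → a ! * k !) m′+j≡b ⟩
  a ! * b !          ∎
  where
  open ≤-Reasoning
  m = ⌊ a + b /2⌋
  m′ = ⌈ a + b /2⌉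
  j = m ∸ a

  a+j≡m : a + j ≡ m
  a+j≡m = m+[n∸m]≡n (≤-trans (≤-reflexive (n≡⌊n+n/2⌋ a)) (⌊n/2⌋-mono (+-monoʳ-≤ a a≤b)))

  m′+j≡b : m′ + j ≡ b
  m′+j≡b = +-cancelˡ-≡ a (m′ + j) b (begin-equality
    a + (m′ + j)   ≡⟨ cong (a +_) (+-comm m′ j) ⟩
    a + (j + m′)   ≡⟨ +-assoc a j m′ ⟨
    a + j + m′     ≡⟨ cong (_+ m′) a+j≡m ⟩
    m + m′         ≡⟨ ⌊n/2⌋+⌈n/2⌉≡n (a + b) ⟩
    a + b          ∎)

⌊n/2⌋!*⌈n/2⌉!-minimal : ∀ a b → ⌊ a + b /2⌋ ! * ⌈ a + b /2⌉ ! ≤ a ! * b !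
⌊n/2⌋!*⌈n/2⌉!-minimal a b with ≤-total a b
... | inj₁ a≤b = ⌊n/2⌋!*⌈n/2⌉!-minimal-≤ a≤b
... | inj₂ b≤a = subst₂ (λ n k → ⌊ n /2⌋ ! * ⌈ n /2⌉ ! ≤ k) (+-comm b a) (*-comm (b !) (a !))
                   (⌊n/2⌋!*⌈n/2⌉!-minimal-≤ b≤a)

nCk*k!*[n∸k]!≡n! : ∀ {n k} → k ≤ n → (n C k) * (k ! * (n ∸ k) !) ≡ n !
nCk*k!*[n∸k]!≡n! {n} {k} k≤n =
  trans (cong (_* (k ! * (n ∸ k) !)) (nCk≡n!/k![n-k]! k≤n))
        (m/n*n≡m {{k !* (n ∸ k) !≢0}} (k![n∸k]!∣n! k≤n))

n/2≡⌊n/2⌋ : ∀ n → n / 2 ≡ ⌊ n /2⌋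
n/2≡⌊n/2⌋ zero          = refl
n/2≡⌊n/2⌋ (suc zero)    = refl
n/2≡⌊n/2⌋ (suc (suc n)) =
  trans (m/n≡1+[m∸n]/n {suc (suc n)} (s≤s (s≤s z≤n))) (cong suc (n/2≡⌊n/2⌋ n))

n!≤a!*b!*nC[n/2] : ∀ {a b n} → a + b ≡ n → n ! ≤ a ! * b ! * (n C (n / 2))
n!≤a!*b!*nC[n/2] {a} {b} {n} refl = begin
  n !                            ≡⟨ nCk*k!*[n∸k]!≡n! (⌊n/2⌋≤n n) ⟨
  (n C m) * (m ! * (n ∸ m) !)    ≡⟨ cong (λ k → (n C m) * (m ! * k !)) n∸m≡m′ ⟩
  (n C m) * (m ! * m′ !)         ≤⟨ *-monoʳ-≤ (n C m) (⌊n/2⌋!*⌈n/2⌉!-minimal a b) ⟩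
  (n C m) * (a ! * b !)          ≡⟨ *-comm (n C m) (a ! * b !) ⟩
  a ! * b ! * (n C m)            ≡⟨ cong (λ k → a ! * b ! * (n C k)) (n/2≡⌊n/2⌋ n) ⟨
  a ! * b ! * (n C (n / 2))      ∎
  where
  open ≤-Reasoning
  m = ⌊ n /2⌋
  m′ = ⌈ n /2⌉
  n∸m≡m′ : n ∸ m ≡ m′
  n∸m≡m′ = trans (cong (_∸ m) (sym (⌊n/2⌋+⌈n/2⌉≡n n))) (m+n∸m≡n m m′)

2*n!≤n!*nC[n/2] : ∀ {n} → 2 ≤ n → 2 * n ! ≤ n ! * (n C (n / 2))
2*n!≤n!*nC[n/2] {suc m} 2≤n = begin
  2 * suc m !                  ≤⟨ *-monoˡ-≤ (suc m !) 2≤n ⟩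
  suc m * suc m !              ≤⟨ *-monoʳ-≤ (suc m) (n!≤a!*b!*nC[n/2] {1} {m} refl) ⟩
  suc m * (1 ! * m ! * central)  ≡⟨ cong (λ k → suc m * (k * central)) (*-identityˡ (m !)) ⟩
  suc m * (m ! * central)        ≡⟨ *-assoc (suc m) (m !) central ⟨
  suc m ! * central              ∎
  where
  open ≤-Reasoning
  central = suc m C (suc m / 2)

n*[2ⁿ*n!]≡n!*[2*n]*2ⁿ⁻¹ : ∀ {n} → 1 ≤ n → n * (2 ^ n * n !) ≡ n ! * (2 * n) * 2 ^ (n ∸ 1)
n*[2ⁿ*n!]≡n!*[2*n]*2ⁿ⁻¹ {suc m} _ =
  solve 3 (λ m p q → (con 1 :+ m) :* ((con 2 :* p) :* q) := (q :* (con 2 :* (con 1 :+ m))) :* p)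
          refl m (2 ^ m) (suc m !)
  where open +-*-Solver

module _ {A B : Set} (g : A → List B) where

  length-concatMap : ∀ {c} xs → (∀ {x} → x ∈ xs → length (g x) ≡ c) →
                     length (concatMap g xs) ≡ length xs * c
  length-concatMap []       _   = refl
  length-concatMap (x ∷ xs) len =
    trans (length-++ (g x)) (cong₂ _+_ (len (here refl)) (length-concatMap xs (len ∘ there)))

  concatMap-unique : ∀ {xs} → Unique xs → (∀ {x} → x ∈ xs → Unique (g x)) →
                     (∀ {x y z} → x ∈ xs → y ∈ xs → z ∈ g x → z ∈ g y → x ≡ y) →
                     Unique (concatMap g xs)
  concatMap-unique {[]}     []            _  _        = []
  concatMap-unique {x ∷ xs} (x∉xs ∷ xs!) g! g-apart =
    Unique.++⁺ (g! (here refl)) (concatMap-unique xs! (g! ∘ there) (λ p q → g-apart (there p) (there q))) apart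
    where
    apart : Disjoint (g x) (concatMap g xs)
    apart (z∈gx , z∈rest) with find (∈-concatMap⁻ g z∈rest)
    ... | y , y∈xs , z∈gy = All.lookup x∉xs y∈xs (g-apart (here refl) (there y∈xs) z∈gx z∈gy)

length-cartesianProductWith : ∀ {A B C : Set} (h : A → B → C) xs ys →
                              length (cartesianProductWith h xs ys) ≡ length xs * length ys
length-cartesianProductWith h []       ys = refl
length-cartesianProductWith h (x ∷ xs) ys =
  trans (length-++ (map (h x) ys)) (cong₂ _+_ (length-map (h x) ys) (length-cartesianProductWith h xs ys))

module _ {A : Set} where

  insertions : A → List A → List (List A)
  insertions x []       = (x ∷ []) ∷ []
  insertions x (y ∷ ys) = (x ∷ y ∷ ys) ∷ map (y ∷_) (insertions x ys)

  permutations : List A → List (List A)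
  permutations []       = [] ∷ []
  permutations (x ∷ xs) = concatMap (insertions x) (permutations xs)

  length-insertions : ∀ x ys → length (insertions x ys) ≡ suc (length ys)
  length-insertions x []       = refl
  length-insertions x (y ∷ ys) = cong suc (trans (length-map (y ∷_) (insertions x ys)) (length-insertions x ys))

  ∈-insertions⁻ : ∀ {x} ys {zs} → zs ∈ insertions x ys → zs ↭ x ∷ ys
  ∈-insertions⁻ []       (here refl) = ↭-refl
  ∈-insertions⁻ (y ∷ ys) (here refl) = ↭-refl
  ∈-insertions⁻ {x} (y ∷ ys) (there zs∈) with ∈-map⁻ (y ∷_) zs∈
  ... | rs , rs∈ , refl = ↭-trans (prep y (∈-insertions⁻ ys rs∈)) (swap y x ↭-refl)

  []∉insertions : ∀ {x} ys → [] ∉ insertions x ys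
  []∉insertions []       (here ())
  []∉insertions (y ∷ ys) (here ())
  []∉insertions (y ∷ ys) (there []∈) with ∈-map⁻ (y ∷_) []∈
  ... | _ , _ , ()

  insertions-unique : ∀ {x} ys → x ∉ ys → Unique (insertions x ys)
  insertions-unique []       _    = [] ∷ []
  insertions-unique (y ∷ ys) x∉ys =
    All.map⁺ (All.tabulate λ _ eq → x∉ys (here (∷-injectiveˡ eq)))
    ∷ Unique.map⁺ ∷-injectiveʳ (insertions-unique ys (x∉ys ∘ there))

  insertions-injective : ∀ {x} ys ys′ {zs} → x ∉ ys → x ∉ ys′ →
                         zs ∈ insertions x ys → zs ∈ insertions x ys′ → ys ≡ ys′
  insertions-injective []       []         _ _ _ _ = refl
  insertions-injective []       (y′ ∷ ys′) _ _ (here refl) (there m′) with ∈-map⁻ (y′ ∷_) m′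
  ... | _ , []∈ , refl = ⊥-elim ([]∉insertions ys′ []∈)
  insertions-injective (y ∷ ys) []         _ _ (there m) (here refl) with ∈-map⁻ (y ∷_) m
  ... | _ , []∈ , refl = ⊥-elim ([]∉insertions ys []∈)
  insertions-injective (y ∷ ys) (y′ ∷ ys′) _ _ (here refl) (here refl) = refl
  insertions-injective (y ∷ ys) (y′ ∷ ys′) _ x∉ys′ (here refl) (there m′) with ∈-map⁻ (y′ ∷_) m′
  ... | _ , _ , refl = ⊥-elim (x∉ys′ (here refl))
  insertions-injective (y ∷ ys) (y′ ∷ ys′) x∉ys _ (there m) (here refl) with ∈-map⁻ (y ∷_) m
  ... | _ , _ , refl = ⊥-elim (x∉ys (here refl))
  insertions-injective (y ∷ ys) (y′ ∷ ys′) x∉ys x∉ys′ (there m) (there m′)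
    with ∈-map⁻ (y ∷_) m | ∈-map⁻ (y′ ∷_) m′
  ... | _ , rs∈ , refl | _ , rs∈′ , refl =
    cong (y ∷_) (insertions-injective ys ys′ (x∉ys ∘ there) (x∉ys′ ∘ there) rs∈ rs∈′)

  ∈-permutations⁻ : ∀ xs {ys} → ys ∈ permutations xs → ys ↭ xs
  ∈-permutations⁻ []       (here refl) = ↭-refl
  ∈-permutations⁻ (x ∷ xs) ys∈ with find (∈-concatMap⁻ (insertions x) ys∈)
  ... | zs , zs∈ , ys∈′ = ↭-trans (∈-insertions⁻ zs ys∈′) (prep x (∈-permutations⁻ xs zs∈))

  length-permutations : ∀ xs → length (permutations xs) ≡ length xs !
  length-permutations []       = refl
  length-permutations (x ∷ xs) = begin
    length (concatMap (insertions x) (permutations xs))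
      ≡⟨ length-concatMap (insertions x) (permutations xs)
           (λ {zs} zs∈ → trans (length-insertions x zs) (cong suc (↭-length (∈-permutations⁻ xs zs∈)))) ⟩
    length (permutations xs) * suc (length xs)   ≡⟨ cong (_* suc (length xs)) (length-permutations xs) ⟩
    length xs ! * suc (length xs)                ≡⟨ *-comm (length xs !) (suc (length xs)) ⟩
    suc (length xs) !                            ∎
    where open ≡-Reasoning

  permutations-unique : ∀ {xs} → Unique xs → Unique (permutations xs)
  permutations-unique {[]}     []           = [] ∷ []
  permutations-unique {x ∷ xs} (x∉xs ∷ xs!) =
    concatMap-unique (insertions x) (permutations-unique xs!)
      (λ {zs} zs∈ → insertions-unique zs (x∉ zs∈))
      (λ {zs} {zs′} zs∈ zs′∈ → insertions-injective zs zs′ (x∉ zs∈) (x∉ zs′∈))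
    where
    x∉ : ∀ {zs} → zs ∈ permutations xs → x ∉ zs
    x∉ zs∈ x∈zs = All.lookup x∉xs (∈-resp-↭ (∈-permutations⁻ xs zs∈) x∈zs) refl

  ++-prefix-injective : ∀ (t t′ : List A) {s s′} → length t ≡ length t′ →
                        t ++ s ≡ t′ ++ s′ → t ≡ t′
  ++-prefix-injective []      []        _   _  = refl
  ++-prefix-injective (x ∷ t) (x′ ∷ t′) len eq =
    cong₂ _∷_ (∷-injectiveˡ eq) (++-prefix-injective t t′ (suc-injective len) (∷-injectiveʳ eq))

  blockPermutations : List A → List A → List (List A)
  blockPermutations T S = concatMap (λ t → map (t ++_) (permutations S)) (permutations T)

  ∈-blockPermutations⁻ : ∀ T S {π} → π ∈ blockPermutations T S →
                         ∃₂ λ t s → t ↭ T × s ↭ S × π ≡ t ++ s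
  ∈-blockPermutations⁻ T S π∈ with find (∈-concatMap⁻ (λ t → map (t ++_) (permutations S)) π∈)
  ... | t , t∈ , π∈′ with ∈-map⁻ (t ++_) π∈′
  ...   | s , s∈ , refl = t , s , ∈-permutations⁻ T t∈ , ∈-permutations⁻ S s∈ , refl

  head-blockPermutations : ∀ {x} T S {π} → π ∈ blockPermutations (x ∷ T) S →
                           ∃ λ w → w ∈ x ∷ T × head π ≡ just w
  head-blockPermutations {x} T S π∈ with ∈-blockPermutations⁻ (x ∷ T) S π∈
  ... | []    , _ , t↭ , _ , _    = ⊥-elim (0≢1+n (↭-length t↭))
  ... | w ∷ _ , _ , t↭ , _ , refl = w , ∈-resp-↭ t↭ (here refl) , refl

  length-blockPermutations : ∀ T S → length (blockPermutations T S) ≡ length T ! * length S !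
  length-blockPermutations T S = begin
    length (blockPermutations T S)
      ≡⟨ length-concatMap (λ t → map (t ++_) (permutations S)) (permutations T)
           (λ {t} _ → trans (length-map (t ++_) (permutations S)) (length-permutations S)) ⟩
    length (permutations T) * length S !  ≡⟨ cong (_* length S !) (length-permutations T) ⟩
    length T ! * length S !               ∎
    where open ≡-Reasoning

  blockPermutations-unique : ∀ {T S} → Unique T → Unique S → Unique (blockPermutations T S)
  blockPermutations-unique {T} {S} T! S! =
    concatMap-unique (λ t → map (t ++_) (permutations S)) (permutations-unique T!)
      (λ {t} _ → Unique.map⁺ (++-cancelˡ t _ _) (permutations-unique S!))
      apart
    where
    apart : ∀ {t t′ π} → t ∈ permutations T → t′ ∈ permutations T →
            π ∈ map (t ++_) (permutations S) → π ∈ map (t′ ++_) (permutations S) → t ≡ t′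
    apart {t} {t′} t∈ t′∈ π∈ π∈′ with ∈-map⁻ (t ++_) π∈ | ∈-map⁻ (t′ ++_) π∈′
    ... | _ , _ , refl | _ , _ , eq = ++-prefix-injective t t′
            (trans (↭-length (∈-permutations⁻ T t∈)) (sym (↭-length (∈-permutations⁻ T t′∈)))) eq

  filter-++-filter-∁-↭ : ∀ {p} {P : Pred A p} (P? : Decidable P) xs → filter P? xs ++ filter (∁? P?) xs ↭ xs
  filter-++-filter-∁-↭ P? []       = ↭-refl
  filter-++-filter-∁-↭ P? (x ∷ xs) with P? x
  ... | yes _ = prep x (filter-++-filter-∁-↭ P? xs)
  ... | no  _ = ↭-trans (shift x (filter P? xs) (filter (∁? P?) xs)) (prep x (filter-++-filter-∁-↭ P? xs))

  ∈-drop⁻ : ∀ c {xs : List A} {x} → x ∈ drop c xs → x ∈ xs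
  ∈-drop⁻ zero    x∈ = x∈
  ∈-drop⁻ (suc c) {_ ∷ xs} x∈ = there (∈-drop⁻ c x∈)

  take-drop-disjoint : ∀ c {xs : List A} → Unique xs → Disjoint (take c xs) (drop c xs)
  take-drop-disjoint (suc c) {x ∷ xs} (x∉xs ∷ _)  (here refl , x∈) = All.lookup x∉xs (∈-drop⁻ c x∈) refl
  take-drop-disjoint (suc c) {x ∷ xs} (_ ∷ xs!) (there v∈ , v∈′) = take-drop-disjoint c xs! (v∈ , v∈′)

  lookup∈take : ∀ (xs : List A) i {c} → toℕ i < c → lookup xs i ∈ take c xs
  lookup∈take (x ∷ xs) Fin.zero    {suc c} _         = here refl
  lookup∈take (x ∷ xs) (Fin.suc i) {suc c} (s≤s i<c) = there (lookup∈take xs i i<c)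

  lookup∈drop : ∀ (xs : List A) i {c} → c ≤ toℕ i → lookup xs i ∈ drop c xs
  lookup∈drop xs       i           {zero}  _         = ∈-lookup i
  lookup∈drop (x ∷ xs) (Fin.suc i) {suc c} (s≤s c≤i) = lookup∈drop xs i c≤i

permutation-unique : ∀ {n} {π : List (Fin n)} → IsPermutation π → Unique π
permutation-unique π↭ = Unique-resp-↭ (setoid _) (↭⇒↭ₛ (↭-sym π↭)) (Unique.allFin⁺ _)

length-allFin : ∀ n → length (allFin n) ≡ n
length-allFin n = length-tabulate {n = n} id

module _ {n : ℕ} where

  open import Data.List.Membership.DecPropositional (Fin._≟_ {n}) using (_∈?_)

  cut : Bool → List (Fin n) → ℕ → State n
  cut b π c = tabulate λ v → if does (v ∈? take c π) then b else not b

  lookup-cut-take : ∀ b π c {v} → v ∈ take c π → lookupᵥ (cut b π c) v ≡ b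
  lookup-cut-take b π c {v} v∈ =
    trans (lookup∘tabulate _ v) (cong (if_then b else not b) (dec-true (v ∈? take c π) v∈))

  lookup-cut-drop : ∀ b {π} c {v} → Unique π → v ∈ drop c π → lookupᵥ (cut b π c) v ≡ not b
  lookup-cut-drop b {π} c {v} π! v∈ =
    trans (lookup∘tabulate _ v)
      (cong (if_then b else not b)
        (dec-false (v ∈? take c π) (λ v∈′ → take-drop-disjoint c π! (v∈′ , v∈))))

  cut-injective : ∀ {π} → Unique π → ∀ {b b′} (c c′ : Fin (length π)) →
                  cut b π (toℕ c) ≡ cut b′ π (toℕ c′) → b ≡ b′ × c ≡ c′
  cut-injective {π} π! {b} {b′} c c′ eq = b≡b′ , c≡c′
    where
    at : ∀ i → lookupᵥ (cut b π (toℕ c)) (lookup π i) ≡ lookupᵥ (cut b′ π (toℕ c′)) (lookup π i)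
    at i = cong (λ Z → lookupᵥ Z (lookup π i)) eq

    before : ∀ a k i → toℕ i < toℕ k → lookupᵥ (cut a π (toℕ k)) (lookup π i) ≡ a
    before a k i i<k = lookup-cut-take a π (toℕ k) (lookup∈take π i i<k)

    after : ∀ a k i → toℕ k ≤ toℕ i → lookupᵥ (cut a π (toℕ k)) (lookup π i) ≡ not a
    after a k i k≤i = lookup-cut-drop a (toℕ k) π! (lookup∈drop π i k≤i)

    b≡b′ : b ≡ b′
    b≡b′ with Finₚ.≤-total c c′
    ... | inj₁ c≤c′ =
      not-injective (trans (sym (after b c c′ c≤c′)) (trans (at c′) (after b′ c′ c′ ≤-refl)))
    ... | inj₂ c′≤c =
      not-injective (trans (sym (after b c c ≤-refl)) (trans (at c) (after b′ c′ c c′≤c)))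

    c≡c′ : c ≡ c′
    c≡c′ with Finₚ.<-cmp c c′
    ... | tri< c<c′ _ _ = ⊥-elim (not-¬ refl (sym (trans (sym (after b c c ≤-refl))
                            (trans (at c) (trans (before b′ c′ c c<c′) (sym b≡b′))))))
    ... | tri≈ _ c≡c′ _ = c≡c′
    ... | tri> _ _ c′<c = ⊥-elim (not-¬ refl (trans (sym (before b c c′ c′<c))
                            (trans (at c′) (trans (after b′ c′ c′ ≤-refl) (cong not (sym b≡b′))))))

  cuts : List (Fin n) → List (State n)
  cuts π = cartesianProductWith (λ b c → cut b π (toℕ c)) (false ∷ true ∷ []) (allFin (length π))

  ∈-cuts⁻ : ∀ π {X} → X ∈ cuts π → ∃₂ λ b c → X ≡ cut b π c
  ∈-cuts⁻ π X∈
    with ∈-cartesianProductWith⁻ (λ b c → cut b π (toℕ c)) (false ∷ true ∷ []) (allFin (length π)) X∈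
  ... | b , c , _ , _ , refl = b , toℕ c , refl

  cuts-unique : ∀ {π} → Unique π → Unique (cuts π)
  cuts-unique π! = Unique.cartesianProductWith⁺ _ (λ {b} {b′} {c} {c′} → cut-injective π! c c′)
    (((λ ()) ∷ []) ∷ [] ∷ []) (Unique.allFin⁺ _)

  length-cuts : ∀ π → length (cuts π) ≡ 2 * length π
  length-cuts π =
    trans (length-cartesianProductWith (λ b c → cut b π (toℕ c)) (false ∷ true ∷ []) (allFin (length π)))
          (cong (2 *_) (length-allFin (length π)))

  statePermutationPairs : List (State n × List (Fin n))
  statePermutationPairs = concatMap (λ π → map (_, π) (cuts π)) (permutations (allFin n))

  statePermutationPairs-unique : Unique statePermutationPairs
  statePermutationPairs-unique =
    concatMap-unique (λ π → map (_, π) (cuts π)) (permutations-unique (Unique.allFin⁺ n))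
      (λ π∈ → Unique.map⁺ (cong proj₁)
                (cuts-unique (permutation-unique (∈-permutations⁻ (allFin n) π∈))))
      apart
    where
    apart : ∀ {π π′ p} → π ∈ permutations (allFin n) → π′ ∈ permutations (allFin n) →
            p ∈ map (_, π) (cuts π) → p ∈ map (_, π′) (cuts π′) → π ≡ π′
    apart {π} {π′} _ _ p∈ p∈′ with ∈-map⁻ (_, π) p∈ | ∈-map⁻ (_, π′) p∈′
    ... | _ , _ , refl | _ , _ , refl = refl

  length-statePermutationPairs : length statePermutationPairs ≡ n ! * (2 * n)
  length-statePermutationPairs = begin
    length statePermutationPairs
      ≡⟨ length-concatMap (λ π → map (_, π) (cuts π)) (permutations (allFin n)) |pairs-of|≡2n ⟩
    length (permutations (allFin n)) * (2 * n)
      ≡⟨ cong (_* (2 * n)) (trans (length-permutations (allFin n)) (cong _! (length-allFin n))) ⟩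
    n ! * (2 * n) ∎
    where
    open ≡-Reasoning
    |pairs-of|≡2n : ∀ {π} → π ∈ permutations (allFin n) → length (map (_, π) (cuts π)) ≡ 2 * n
    |pairs-of|≡2n {π} π∈ = trans (length-map (_, π) (cuts π)) (trans (length-cuts π)
      (cong (2 *_) (trans (↭-length (∈-permutations⁻ (allFin n) π∈)) (length-allFin n))))

  n*2ⁿ*n!≤|statePermutationPairs|*2ⁿ⁻¹ : 1 ≤ n →
                                        n * (2 ^ n * n !) ≤ length statePermutationPairs * 2 ^ (n ∸ 1)
  n*2ⁿ*n!≤|statePermutationPairs|*2ⁿ⁻¹ 1≤n = ≤-reflexive
    (trans (n*[2ⁿ*n!]≡n!*[2*n]*2ⁿ⁻¹ 1≤n) (cong (_* 2 ^ (n ∸ 1)) (sym length-statePermutationPairs)))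

module _ {n : ℕ} (f : Fin n → State n → Bool) (mono : IsMonotone f) where

  module _ (X : State n) where

    level : Bool → List (Fin n)
    level d = filter (λ v → lookupᵥ X v Bool.≟ d) (allFin n)

    offLevel : Bool → List (Fin n)
    offLevel d = filter (∁? (λ v → lookupᵥ X v Bool.≟ d)) (allFin n)

    orderings : Bool → List (List (Fin n))
    orderings d = blockPermutations (level d) (offLevel d)

    level-++-offLevel : ∀ d → level d ++ offLevel d ↭ allFin n
    level-++-offLevel d = filter-++-filter-∁-↭ (λ v → lookupᵥ X v Bool.≟ d) (allFin n)

    length-level+offLevel : ∀ d → length (level d) + length (offLevel d) ≡ n
    length-level+offLevel d =
      trans (sym (length-++ (level d))) (trans (↭-length (level-++-offLevel d)) (length-allFin n))

    level-≡ : ∀ d → All (λ v → lookupᵥ X v ≡ d) (level d)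
    level-≡ d = All.all-filter _ (allFin n)

    offLevel-≡not : ∀ d → All (λ v → lookupᵥ X v ≡ not d) (offLevel d)
    offLevel-≡not d = All.map ¬-not (All.all-filter _ (allFin n))

    ∈-orderings⁻ : ∀ d {π} → π ∈ orderings d →
                   IsPermutation π × (IsGardenOfEden f π X ⊎ ReachesFixedPoint f π X)
    ∈-orderings⁻ d π∈ with ∈-blockPermutations⁻ (level d) (offLevel d) π∈
    ... | t , s , t↭ , s↭ , refl =
      ↭-trans (++⁺ t↭ s↭) (level-++-offLevel d) ,
      goe-or-reaches-fixed-point f mono d t s
        (All-resp-↭ (↭-sym t↭) (level-≡ d)) (All-resp-↭ (↭-sym s↭) (offLevel-≡not d))

    orderings-unique : ∀ d → Unique (orderings d)
    orderings-unique d =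
      blockPermutations-unique (Unique.filter⁺ _ (Unique.allFin⁺ n)) (Unique.filter⁺ _ (Unique.allFin⁺ n))

    n!≤|orderings|*nC[n/2] : ∀ d → n ! ≤ length (orderings d) * (n C (n / 2))
    n!≤|orderings|*nC[n/2] d =
      subst (λ k → n ! ≤ k * (n C (n / 2))) (sym (length-blockPermutations (level d) (offLevel d)))
        (n!≤a!*b!*nC[n/2] {length (level d)} {length (offLevel d)} (length-level+offLevel d))

    length-orderings-constant : ∀ d → level d ≡ [] → length (orderings d) ≡ n !
    length-orderings-constant d level≡[] = begin
      length (orderings d)                       ≡⟨ length-blockPermutations (level d) (offLevel d) ⟩
      length (level d) ! * length (offLevel d) ! ≡⟨ cong₂ (λ a b → a ! * b !) |level|≡0 |offLevel|≡n ⟩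
      1 * n !                                    ≡⟨ *-identityˡ (n !) ⟩
      n !                                        ∎
      where
      open ≡-Reasoning
      |level|≡0 : length (level d) ≡ 0
      |level|≡0 = cong length level≡[]
      |offLevel|≡n : length (offLevel d) ≡ n
      |offLevel|≡n = trans (cong (_+ length (offLevel d)) (sym |level|≡0)) (length-level+offLevel d)

    orderings-head : ∀ d {v vs π} → level d ≡ v ∷ vs → π ∈ orderings d →
                     ∃ λ w → head π ≡ just w × lookupᵥ X w ≡ d
    orderings-head d level≡ π∈
      with head-blockPermutations _ (offLevel d)
             (subst (λ T → _ ∈ blockPermutations T (offLevel d)) level≡ π∈)
    ... | w , w∈ , head≡w = w , head≡w , All.lookup (level-≡ d) (subst (w ∈_) (sym level≡) w∈)

    ManyGoodPermutations : Set
    ManyGoodPermutations =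
      Σ (List (List (Fin n))) λ L →
        Unique L × All IsPermutation L ×
        All (λ π → IsGardenOfEden f π X ⊎ ReachesFixedPoint f π X) L ×
        2 * (n !) ≤ length L * (n C (n / 2))

    orderings-of-constant-state : 2 ≤ n → ∀ d → level d ≡ [] → ManyGoodPermutations
    orderings-of-constant-state 2≤n d level≡[] =
      orderings d , orderings-unique d ,
      All.tabulate (proj₁ ∘ ∈-orderings⁻ d) , All.tabulate (proj₂ ∘ ∈-orderings⁻ d) ,
      subst (λ k → 2 * n ! ≤ k * (n C (n / 2))) (sym (length-orderings-constant d level≡[]))
        (2*n!≤n!*nC[n/2] 2≤n)

    orderings-of-nonconstant-state : ∀ {v vs w ws} → level false ≡ v ∷ vs → level true ≡ w ∷ ws →
                                     ManyGoodPermutations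
    orderings-of-nonconstant-state level₀≡ level₁≡ =
      orderings false ++ orderings true ,
      Unique.++⁺ (orderings-unique false) (orderings-unique true) apart ,
      All.++⁺ (All.tabulate (proj₁ ∘ ∈-orderings⁻ false)) (All.tabulate (proj₁ ∘ ∈-orderings⁻ true)) ,
      All.++⁺ (All.tabulate (proj₂ ∘ ∈-orderings⁻ false)) (All.tabulate (proj₂ ∘ ∈-orderings⁻ true)) ,
      bound
      where
      apart : Disjoint (orderings false) (orderings true)
      apart (π∈₀ , π∈₁) with orderings-head false level₀≡ π∈₀ | orderings-head true level₁≡ π∈₁
      ... | u , hd≡u , Xu≡false | u′ , hd≡u′ , Xu′≡true with trans (sym hd≡u) hd≡u′
      ...   | refl with trans (sym Xu≡false) Xu′≡true
      ...     | ()

      bound : 2 * n ! ≤ length (orderings false ++ orderings true) * (n C (n / 2))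
      bound = begin
        2 * n !
          ≤⟨ +-mono-≤ (n!≤|orderings|*nC[n/2] false) (+-mono-≤ (n!≤|orderings|*nC[n/2] true) z≤n) ⟩
        ∣O₀∣ * central + (∣O₁∣ * central + 0)
          ≡⟨ cong (∣O₀∣ * central +_) (+-identityʳ (∣O₁∣ * central)) ⟩
        ∣O₀∣ * central + ∣O₁∣ * central
          ≡⟨ *-distribʳ-+ central ∣O₀∣ ∣O₁∣ ⟨
        (∣O₀∣ + ∣O₁∣) * central
          ≡⟨ cong (_* central) (length-++ (orderings false)) ⟨
        length (orderings false ++ orderings true) * central ∎
        where
        open ≤-Reasoning
        central = n C (n / 2)
        ∣O₀∣ = length (orderings false)
        ∣O₁∣ = length (orderings true)

    many-good-permutations : 2 ≤ n → ManyGoodPermutations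
    many-good-permutations 2≤n with level false in level₀≡ | level true in level₁≡
    ... | []    | _     = orderings-of-constant-state 2≤n false level₀≡
    ... | _ ∷ _ | []    = orderings-of-constant-state 2≤n true level₁≡
    ... | _ ∷ _ | _ ∷ _ = orderings-of-nonconstant-state level₀≡ level₁≡

  cut-goe-or-reaches-fixed-point : ∀ {π} → Unique π → ∀ b c →
                                   IsGardenOfEden f π (cut b π c) ⊎ ReachesFixedPoint f π (cut b π c)
  cut-goe-or-reaches-fixed-point {π} π! b c =
    subst (λ ρ → IsGardenOfEden f ρ (cut b π c) ⊎ ReachesFixedPoint f ρ (cut b π c)) (take++drop≡id c π)
    (goe-or-reaches-fixed-point f mono b (take c π) (drop c π)
      (All.tabulate (lookup-cut-take b π c)) (All.tabulate (lookup-cut-drop b c π!)))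

  ∈-statePermutationPairs⁻ : ∀ {p} → p ∈ statePermutationPairs →
    IsPermutation (proj₂ p) ×
    (IsGardenOfEden f (proj₂ p) (proj₁ p) ⊎ ReachesFixedPoint f (proj₂ p) (proj₁ p))
  ∈-statePermutationPairs⁻ p∈ with find (∈-concatMap⁻ (λ π → map (_, π) (cuts π)) p∈)
  ... | π , π∈ , p∈′ with ∈-map⁻ (_, π) p∈′
  ...   | X , X∈ , refl with ∈-cuts⁻ π X∈
  ...     | b , c , refl = π↭ , cut-goe-or-reaches-fixed-point (permutation-unique π↭) b c
    where
    π↭ : IsPermutation π
    π↭ = ∈-permutations⁻ (allFin n) π∈

corollary3p16 : (n : ℕ) → 1 < n → (G : SimpleGraph n) → (f : Fin n → State n → Bool) →
    IsLocal G f → IsMonotone f →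
    ((X : State n) →
      Σ (List (List (Fin n))) λ L →
        Unique L ×
        All IsPermutation L ×
        All (λ π → IsGardenOfEden f π X ⊎ ReachesFixedPoint f π X) L ×
        2 * (n !) ≤ length L * (n C (n / 2)))
    ×
    (Σ (List (State n × List (Fin n))) λ L →
        Unique L ×
        All (λ p → IsPermutation (proj₂ p)) L ×
        All (λ p → IsGardenOfEden f (proj₂ p) (proj₁ p) ⊎ ReachesFixedPoint f (proj₂ p) (proj₁ p)) L ×
        n * (2 ^ n * n !) ≤ length L * 2 ^ (n ∸ 1))
corollary3p16 n 1<n _ f _ mono =
  (λ X → many-good-permutations f mono X 1<n) ,
  ( statePermutationPairs
  , statePermutationPairs-unique
  , All.tabulate (proj₁ ∘ ∈-statePermutationPairs⁻ f mono)
  , All.tabulate (proj₂ ∘ ∈-statePermutationPairs⁻ f mono)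
  , n*2ⁿ*n!≤|statePermutationPairs|*2ⁿ⁻¹ (<⇒≤ 1<n))
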